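{- Let $G$ be a toroidal map given with a Schnyder wood, and consider the corresponding angle labeling. Then the labels of the angles at each vertex and at each face form, in counterclockwise order, nonempty intervals of $0$'s, $1$'s and $2$'s.
   Context: A toroidal map is a graph embedded on the torus with no contractible loop, no two edges with same endpoints whose union is a contractible cycle, and all faces open disks. A Schnyder wood is an orientation and coloring of its edges with colors $0,1,2$ (indices modulo 3), each edge oriented in one direction or in two opposite directions (with distinct colors), such that (T1) every vertex $v$ has out-degree exactly one in each color, the edges $e_0(v),e_1(v),e_2(v)$ leaving $v$ in colors $0,1,2$ occur in counterclockwise order, and each edge entering $v$ in color $i$ enters in the counterclockwise sector from $e_{i+1}(v)$ to $e_{i-1}(v)$; (T2) every monochromatic cycle of color $i$ (directed cycle of edges colored $i$, oriented by color $i$) intersects at least one monochromatic cycle of color $i-1$ and at least one of color $i+1$. The angle labeling corresponding to the Schnyder wood labels every angle at a vertex $v$ lying in the counterclockwise sector between $e_{i+1}(v)$ and $e_{i-1}(v)$ with label $i$. -}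

module Defs where

open import Data.Nat using (ℕ; zero; suc; _+_; _≤_; _<_; _≤?_)
open import Data.Fin using (Fin; toℕ; _≟_)
import Data.Fin as F
open import Data.Fin.Properties using (all?)
open import Data.Integer as ℤ using (ℤ)
open import Data.List using (List; length; filter)
open import Data.List using () renaming (allFin to listAllFin)
open import Data.Maybe using (Maybe; just; nothing)
open import Data.Product using (Σ; _×_; _,_; ∃)
open import Data.Sum using (_⊎_)
open import Relation.Binary.PropositionalEquality using (_≡_; _≢_)
open import Relation.Nullary using (Dec; yes; no; ¬_)

iter : ∀ {A : Set} → (A → A) → ℕ → A → A
iter f zero    x = x
iter f (suc n) x = f (iter f n x)

Color : Set
Color = Fin 3

c0 c1 c2 : Color
c0 = F.zero
c1 = F.suc F.zero
c2 = F.suc (F.suc F.zero)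

next : Color → Color
next F.zero = c1
next (F.suc F.zero) = c2
next (F.suc (F.suc F.zero)) = c0

prev : Color → Color
prev F.zero = c2
prev (F.suc F.zero) = c0
prev (F.suc (F.suc F.zero)) = c1

SameOrbit : ∀ {n} → (Fin n → Fin n) → Fin n → Fin n → Set
SameOrbit ρ d d' = Σ ℕ λ k → iter ρ k d ≡ d'

-- d is the (index-)minimal element of its ρ-orbit
-- (for a permutation of Fin n, every orbit element is reached in < n steps)
IsOrbitRep : ∀ {n} → (Fin n → Fin n) → Fin n → Set
IsOrbitRep {n} ρ d = (k : Fin n) → toℕ d ≤ toℕ (iter ρ (toℕ k) d)

isOrbitRep? : ∀ {n} (ρ : Fin n → Fin n) (d : Fin n) → Dec (IsOrbitRep ρ d)
isOrbitRep? ρ d = all? (λ k → toℕ d ≤? toℕ (iter ρ (toℕ k) d))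

numOrbits : ∀ {n} → (Fin n → Fin n) → ℕ
numOrbits {n} ρ = length (filter (isOrbitRep? ρ) (listAllFin n))

-- Darts are Fin D; α is the fixed-point-free involution pairing the two
-- darts of an edge; σ is the counterclockwise rotation of darts around
-- their tail vertex (σ⁻ its inverse).  Vertices = σ-orbits, edges =
-- α-orbits.  The angle (corner) at the tail of dart d between d and σ d
-- is indexed by d; faces = orbits of φ = α ∘ σ acting on angles
-- (φ walks clockwise around a face, so σ⁻ ∘ α is the counterclockwise
-- successor of an angle around its face).

data Reach {D : ℕ} (α σ : Fin D → Fin D) : Fin D → Fin D → Set where
  here  : ∀ {d} → Reach α σ d d
  stepσ : ∀ {d d'} → Reach α σ (σ d) d' → Reach α σ d d'
  stepα : ∀ {d d'} → Reach α σ (α d) d' → Reach α σ d d'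

-- integer 1-chain of the oriented dart d (value on darts, antisymmetric)
dartChain : ∀ {D} → (Fin D → Fin D) → Fin D → Fin D → ℤ
dartChain α d x with x ≟ d
... | yes _ = ℤ.+ 1
... | no _ with x ≟ α d
...   | yes _ = ℤ.- (ℤ.+ 1)
...   | no _  = ℤ.+ 0

-- a 1-chain c (antisymmetric function on darts) is the boundary of a
-- 2-chain, i.e. of an integer weighting w of the faces
-- (w constant on faces = φ-orbits, φ = α ∘ σ); the dart e separates the
-- faces of the angles e and α e.  On the torus (π₁ abelian) a closed walk
-- is contractible iff its chain is such a boundary.
IsBoundary : ∀ {D} → (α σ : Fin D → Fin D) → (Fin D → ℤ) → Set
IsBoundary {D} α σ c =
  Σ (Fin D → ℤ) λ w →
    ((d : Fin D) → w (α (σ d)) ≡ w d) ×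
    ((d : Fin D) → c d ≡ w d ℤ.- w (α d))

record ToroidalMap : Set where
  field
    D      : ℕ
    α      : Fin D → Fin D
    σ      : Fin D → Fin D
    σ⁻     : Fin D → Fin D
    α-invol : ∀ d → α (α d) ≡ d
    α-nofix : ∀ d → α d ≢ d
    σσ⁻     : ∀ d → σ (σ⁻ d) ≡ d
    σ⁻σ     : ∀ d → σ⁻ (σ d) ≡ d
    -- connected (all faces open disks: automatic for a rotation system)
    connected : ∀ d d' → Reach α σ d d'
    -- genus 1 (orientable, Euler characteristic V - E + F = 0)
    euler : numOrbits σ + numOrbits (λ d → α (σ d)) ≡ numOrbits α
    noContractibleLoop : ∀ d → SameOrbit σ d (α d) →
      ¬ IsBoundary α σ (dartChain α d)
    -- no two distinct edges with the same endpoints whose union is a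
    -- contractible cycle (d₁, d₂ have the same tail and the same head)
    noContractibleMultiEdge : ∀ d₁ d₂ → d₂ ≢ d₁ → d₂ ≢ α d₁ →
      SameOrbit σ d₁ d₂ → SameOrbit σ (α d₁) (α d₂) →
      ¬ IsBoundary α σ (λ x → dartChain α d₁ x ℤ.- dartChain α d₂ x)

module _ (M : ToroidalMap) where
  open ToroidalMap M

  SameVertex : Fin D → Fin D → Set
  SameVertex = SameOrbit σ

  -- dart d lies in the counterclockwise (closed) sector from a to b
  -- around their common vertex
  Between : Fin D → Fin D → Fin D → Set
  Between a d b =
    Σ ℕ λ l → iter σ l a ≡ b × (∀ j → j < l → iter σ j a ≢ b) ×
      (Σ ℕ λ k → k ≤ l × iter σ k a ≡ d)

  -- An orientation+colouring: out d = just i  iff the edge of d is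
  -- oriented away from the tail of d in colour i.  The edge of d enters
  -- the tail of d in colour i iff out (α d) = just i.
  record MonoCycle (out : Fin D → Maybe Color) (i : Color) : Set where
    field
      len     : ℕ
      len>0   : 0 < len
      dart    : ℕ → Fin D
      periodic : ∀ k → dart (k + len) ≡ dart k
      colored : ∀ k → out (dart k) ≡ just i
      linked  : ∀ k → SameVertex (α (dart k)) (dart (suc k))

  Intersect : ∀ {out i j} → MonoCycle out i → MonoCycle out j → Set
  Intersect C C' = Σ ℕ λ k → Σ ℕ λ l →
    SameVertex (MonoCycle.dart C k) (MonoCycle.dart C' l)

  record SchnyderWood : Set where
    field
      out : Fin D → Maybe Color
      oriented : ∀ d → out d ≢ nothing ⊎ out (α d) ≢ nothing
      biDistinct : ∀ d i j → out d ≡ just i → out (α d) ≡ just j → i ≢ j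
      outExists : ∀ d i → Σ (Fin D) λ a → SameVertex d a × out a ≡ just i
      outUnique : ∀ a b i → SameVertex a b → out a ≡ just i → out b ≡ just i → a ≡ b
      ccwOrder : ∀ a b c → SameVertex a b → SameVertex a c →
        out a ≡ just c0 → out b ≡ just c1 → out c ≡ just c2 → Between a b c
      inSector : ∀ d i a b → SameVertex d a → SameVertex d b →
        out (α d) ≡ just i → out a ≡ just (next i) → out b ≡ just (prev i) →
        Between a d b
      T2-next : ∀ i (C : MonoCycle out i) →
        Σ (MonoCycle out (next i)) λ C' → Intersect C C'
      T2-prev : ∀ i (C : MonoCycle out i) →
        Σ (MonoCycle out (prev i)) λ C' → Intersect C C'

  IsAngleLabeling : SchnyderWood → (Fin D → Color) → Set
  IsAngleLabeling W lab = ∀ d i a b → SameVertex d a → SameVertex d b →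
    out a ≡ just (next i) → out b ≡ just (prev i) →
    Between a d b → d ≢ b → lab d ≡ i
    where open SchnyderWood W

ThreeIntervals : ∀ {n} → (Fin n → Fin n) → (Fin n → Color) → Fin n → Set
ThreeIntervals {n} ρ lab d =
  Σ (Fin n) λ d₀ → SameOrbit ρ d d₀ ×
  (Σ ℕ λ p → Σ ℕ λ k₁ → Σ ℕ λ k₂ →
    0 < k₁ × k₁ < k₂ × k₂ < p ×
    iter ρ p d₀ ≡ d₀ × (∀ j → 0 < j → j < p → iter ρ j d₀ ≢ d₀) ×
    (∀ j → j < k₁ → lab (iter ρ j d₀) ≡ c0) ×
    (∀ j → k₁ ≤ j → j < k₂ → lab (iter ρ j d₀) ≡ c1) ×
    (∀ j → k₂ ≤ j → j < p → lab (iter ρ j d₀) ≡ c2))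

-- Around a vertex the labels only ever advance from i to i + 1, and they do so exactly
-- at the outgoing darts; with one outgoing dart per colour this gives three steps, i.e.
-- three intervals.  Along a face the labels also only advance by one, so the number of
-- steps is a multiple of 3, and it is not 0: a face without steps is bounded by two-way
-- edges forming a monochromatic cycle of colour i + 1, which by (T2) meets a cycle of
-- colour i, whose incoming edge would have to enter between two consecutive darts of the
-- face.  Finally every edge accounts for exactly three units (its outgoing darts plus the
-- steps on its two sides), so with three outgoing darts per vertex and Euler's formula
-- V - E + F = 0 the faces carry 3F steps in total, hence exactly three each.

module Submission where

open import Defs
open import Data.Nat using (ℕ; zero; suc; pred; >-nonZero; _+_; _*_; _∸_; _≤_; _<_; z≤n; s≤s; s≤s⁻¹; _≤?_; _<?_)
  renaming (_≟_ to _≟ℕ_)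
open import Data.Nat.Properties hiding (_≟_)
open import Data.Fin as F using (Fin; toℕ; fromℕ<; _≟_)
open import Data.Fin.Properties as FP using (toℕ<n; toℕ-fromℕ<; toℕ-inject₁; toℕ-fromℕ)
open import Data.Product using (Σ; _×_; _,_; proj₁; proj₂; curry)
open import Data.Sum using (_⊎_; inj₁; inj₂; [_,_]′)
open import Data.Empty using (⊥; ⊥-elim)
open import Data.Maybe using (Maybe; just; nothing)
open import Data.Maybe.Properties using (just-injective) renaming (≡-dec to ≡-dec-Maybe)
open import Data.List using (length; filter; tabulate)
open import Relation.Binary using (tri<; tri≈; tri>)
open import Function using (_∘_)
open import Relation.Binary.PropositionalEquality
open import Relation.Nullary using (Dec; yes; no; ¬_; ¬?)
open import Relation.Nullary.Decidable using (decidable-stable; map′; _×-dec_)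
open import Relation.Unary using (Decidable)
open import Algebra.Properties.Semiring.Sum +-*-semiring
  using (sum; sum-cong-≗; sum-remove; sum-init-last; ∑-comm; ∑-distrib-+; *-distribˡ-sum; *-distribʳ-sum)
open import Algebra.Properties.CommutativeSemigroup +-commutativeSemigroup using (interchange)

next≢id : ∀ x → next x ≢ x
next≢id F.zero ()
next≢id (F.suc F.zero) ()
next≢id (F.suc (F.suc F.zero)) ()

next²≢id : ∀ x → next (next x) ≢ x
next²≢id F.zero ()
next²≢id (F.suc F.zero) ()
next²≢id (F.suc (F.suc F.zero)) ()

next∘prev : ∀ x → next (prev x) ≡ x
next∘prev F.zero = refl
next∘prev (F.suc F.zero) = refl
next∘prev (F.suc (F.suc F.zero)) = refl

prev∘next : ∀ x → prev (next x) ≡ x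
prev∘next F.zero = refl
prev∘next (F.suc F.zero) = refl
prev∘next (F.suc (F.suc F.zero)) = refl

next∘next : ∀ x → next (next x) ≡ prev x
next∘next F.zero = refl
next∘next (F.suc F.zero) = refl
next∘next (F.suc (F.suc F.zero)) = refl

prev∘prev : ∀ x → prev (prev x) ≡ next x
prev∘prev F.zero = refl
prev∘prev (F.suc F.zero) = refl
prev∘prev (F.suc (F.suc F.zero)) = refl

prev≢id : ∀ x → prev x ≢ x
prev≢id x = next²≢id x ∘ trans (next∘next x)


≢⇒next⊎prev : ∀ i j → i ≢ j → j ≡ next i ⊎ j ≡ prev i
≢⇒next⊎prev F.zero F.zero i≢j = ⊥-elim (i≢j refl)
≢⇒next⊎prev F.zero (F.suc F.zero) _ = inj₁ refl
≢⇒next⊎prev F.zero (F.suc (F.suc F.zero)) _ = inj₂ refl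
≢⇒next⊎prev (F.suc F.zero) F.zero _ = inj₂ refl
≢⇒next⊎prev (F.suc F.zero) (F.suc F.zero) i≢j = ⊥-elim (i≢j refl)
≢⇒next⊎prev (F.suc F.zero) (F.suc (F.suc F.zero)) _ = inj₁ refl
≢⇒next⊎prev (F.suc (F.suc F.zero)) F.zero _ = inj₁ refl
≢⇒next⊎prev (F.suc (F.suc F.zero)) (F.suc F.zero) _ = inj₂ refl
≢⇒next⊎prev (F.suc (F.suc F.zero)) (F.suc (F.suc F.zero)) i≢j = ⊥-elim (i≢j refl)

𝟙 : ∀ {p} {P : Set p} → Dec P → ℕ
𝟙 (yes _) = 1
𝟙 (no _) = 0

𝟙-yes : ∀ {p} {P : Set p} (d : Dec P) → P → 𝟙 d ≡ 1
𝟙-yes (yes _) _ = refl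
𝟙-yes (no ¬p) p = ⊥-elim (¬p p)

𝟙-no : ∀ {p} {P : Set p} (d : Dec P) → ¬ P → 𝟙 d ≡ 0
𝟙-no (yes p) ¬p = ⊥-elim (¬p p)
𝟙-no (no _) _ = refl

𝟙-cong-⇔ : ∀ {p q} {P : Set p} {Q : Set q} (dp : Dec P) (dq : Dec Q) → (P → Q) → (Q → P) → 𝟙 dp ≡ 𝟙 dq
𝟙-cong-⇔ (yes _) (yes _) _ _ = refl
𝟙-cong-⇔ (yes p) (no ¬q) p→q _ = ⊥-elim (¬q (p→q p))
𝟙-cong-⇔ (no ¬p) (yes q) _ q→p = ⊥-elim (¬p (q→p q))
𝟙-cong-⇔ (no _) (no _) _ _ = refl

𝟙-* : ∀ {p q} {P : Set p} {Q : Set q} (dp : Dec P) (dq : Dec Q) → 𝟙 dp * 𝟙 dq ≡ 𝟙 (dp ×-dec dq)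
𝟙-* (yes _) (yes _) = refl
𝟙-* (yes _) (no _) = refl
𝟙-* (no _) _ = refl

𝟙≤1 : ∀ {p} {P : Set p} (d : Dec P) → 𝟙 d ≤ 1
𝟙≤1 (yes _) = ≤-refl
𝟙≤1 (no _) = z≤n


sum-zero : ∀ {n} (f : Fin n → ℕ) → (∀ i → f i ≡ 0) → sum f ≡ 0
sum-zero {zero} f f≡0 = refl
sum-zero {suc n} f f≡0 = cong₂ _+_ (f≡0 F.zero) (sum-zero (f ∘ F.suc) (f≡0 ∘ F.suc))

sum-single : ∀ {n} (f : Fin n → ℕ) (a : Fin n) → (∀ i → i ≢ a → f i ≡ 0) → sum f ≡ f a
sum-single {suc n} f a off-a = begin
  sum f                                   ≡⟨ sum-remove {i = a} f ⟩
  f a + sum (λ j → f (F.punchIn a j))     ≡⟨ cong (f a +_) (sum-zero _ (λ j → off-a _ (FP.punchInᵢ≢i a j))) ⟩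
  f a + 0                                 ≡⟨ +-identityʳ (f a) ⟩
  f a                                     ∎
  where open ≡-Reasoning

sum-select : ∀ {n} (a : Fin n) (h : Fin n → ℕ) → sum (λ d → 𝟙 (a ≟ d) * h d) ≡ h a
sum-select a h = trans (sum-single _ a (λ d d≢a → cong (_* h d) (𝟙-no (a ≟ d) (d≢a ∘ sym))))
                       (trans (cong (_* h a) (𝟙-yes (a ≟ a) refl)) (+-identityʳ (h a)))

sum-δ : ∀ {n} (a : Fin n) → sum (λ d → 𝟙 (a ≟ d)) ≡ 1
sum-δ a = trans (sum-cong-≗ (λ d → sym (*-identityʳ (𝟙 (a ≟ d))))) (sum-select a (λ _ → 1))

sum-mono-≤ : ∀ {n} {f g : Fin n → ℕ} → (∀ i → f i ≤ g i) → sum f ≤ sum g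
sum-mono-≤ {zero} f≤g = z≤n
sum-mono-≤ {suc n} f≤g = +-mono-≤ (f≤g F.zero) (sum-mono-≤ (f≤g ∘ F.suc))

+-mono-≤-≡⇒≡ : ∀ {a b c d} → a ≤ c → b ≤ d → a + b ≡ c + d → a ≡ c × b ≡ d
+-mono-≤-≡⇒≡ {a} {b} {c} {d} a≤c b≤d eq = a≡c , +-cancelˡ-≡ a b d (trans eq (cong (_+ d) (sym a≡c)))
  where
  a≡c : a ≡ c
  a≡c = ≤-antisym a≤c (+-cancelʳ-≤ d c a (≤-trans (≤-reflexive (sym eq)) (+-monoʳ-≤ a b≤d)))

sum-mono-≤-≡⇒≗ : ∀ {n} {f g : Fin n → ℕ} → (∀ i → f i ≤ g i) → sum f ≡ sum g → ∀ i → f i ≡ g i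
sum-mono-≤-≡⇒≗ f≤g eq F.zero = proj₁ (+-mono-≤-≡⇒≡ (f≤g F.zero) (sum-mono-≤ (f≤g ∘ F.suc)) eq)
sum-mono-≤-≡⇒≗ f≤g eq (F.suc i) =
  sum-mono-≤-≡⇒≗ (f≤g ∘ F.suc) (proj₂ (+-mono-≤-≡⇒≡ (f≤g F.zero) (sum-mono-≤ (f≤g ∘ F.suc)) eq)) i

sum≡0⇒≗0 : ∀ {n} (f : Fin n → ℕ) → sum f ≡ 0 → ∀ i → f i ≡ 0
sum≡0⇒≗0 f eq F.zero = m+n≡0⇒m≡0 (f F.zero) eq
sum≡0⇒≗0 f eq (F.suc i) = sum≡0⇒≗0 (f ∘ F.suc) (m+n≡0⇒n≡0 (f F.zero) eq) i

∑< : ℕ → (ℕ → ℕ) → ℕ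
∑< n f = sum {n} (f ∘ toℕ)

∑<-suc : ∀ n (f : ℕ → ℕ) → ∑< (suc n) f ≡ ∑< n f + f n
∑<-suc n f = trans (sum-init-last {n} (f ∘ toℕ))
  (cong₂ _+_ (sum-cong-≗ {n} (cong f ∘ toℕ-inject₁)) (cong f (toℕ-fromℕ n)))

∑<-cong : ∀ n {f g : ℕ → ℕ} → (∀ j → j < n → f j ≡ g j) → ∑< n f ≡ ∑< n g
∑<-cong n f≗g = sum-cong-≗ (λ i → f≗g (toℕ i) (toℕ<n i))

∑<-mono-≤ : ∀ (f : ℕ → ℕ) {m n} → m ≤ n → ∑< m f ≤ ∑< n f
∑<-mono-≤ f {n = zero} z≤n = ≤-refl
∑<-mono-≤ f {m} {suc n} m≤1+n with m≤n⇒m<n∨m≡n m≤1+n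
... | inj₂ refl = ≤-refl
... | inj₁ m<1+n = ≤-trans (∑<-mono-≤ f (s≤s⁻¹ m<1+n)) (≤-trans (m≤m+n _ _) (≤-reflexive (sym (∑<-suc n f))))

-- both sides plus f 0 equal ∑< (suc n) f
∑<-rotate-suc : ∀ n (f : ℕ → ℕ) → f n ≡ f 0 → ∑< n (f ∘ suc) ≡ ∑< n f
∑<-rotate-suc n f fn≡f0 = +-cancelˡ-≡ (f 0) _ _ (begin
  f 0 + ∑< n (f ∘ suc)  ≡⟨ ∑<-suc n f ⟩
  ∑< n f + f n          ≡⟨ cong (∑< n f +_) fn≡f0 ⟩
  ∑< n f + f 0          ≡⟨ +-comm (∑< n f) (f 0) ⟩
  f 0 + ∑< n f          ∎)
  where open ≡-Reasoning

∑<-rotate : ∀ n (f : ℕ → ℕ) → (∀ j → f (j + n) ≡ f j) → ∀ m → ∑< n (λ j → f (j + m)) ≡ ∑< n f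
∑<-rotate n f periodic zero = ∑<-cong n (λ j _ → cong f (+-identityʳ j))
∑<-rotate n f periodic (suc m) = begin
  ∑< n (λ j → f (j + suc m))      ≡⟨ ∑<-cong n (λ j _ → cong f (+-suc j m)) ⟩
  ∑< n (λ j → f (suc j + m))      ≡⟨ ∑<-rotate-suc n (λ j → f (j + m)) (trans (cong f (+-comm n m)) (periodic m)) ⟩
  ∑< n (λ j → f (j + m))          ≡⟨ ∑<-rotate n f periodic m ⟩
  ∑< n f                          ∎
  where open ≡-Reasoning

∑<≢0⇒ : ∀ n (f : ℕ → ℕ) → ∑< n f ≢ 0 → Σ ℕ λ j → j < n × f j ≢ 0
∑<≢0⇒ n f ∑≢0 with FP.any? (λ (i : Fin n) → ¬? (f (toℕ i) ≟ℕ 0))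
... | yes (i , fi≢0) = toℕ i , toℕ<n i , fi≢0
... | no none = ⊥-elim (∑≢0 (sum-zero _ (λ i → decidable-stable (f (toℕ i) ≟ℕ 0) (λ fi≢0 → none (i , fi≢0)))))

least-witness : (P : ℕ → Set) → Decidable P → ∀ {n} → P n →
  Σ ℕ λ m → P m × m ≤ n × (∀ j → j < m → ¬ P j)
least-witness P P? {n} pn with search (suc n)
  where
  search : ∀ n → (∀ j → j < n → ¬ P j) ⊎ (Σ ℕ λ m → P m × m < n × (∀ j → j < m → ¬ P j))
  search zero = inj₁ (λ _ ())
  search (suc n) with search n
  ... | inj₂ (m , pm , m<n , below) = inj₂ (m , pm , m<n⇒m<1+n m<n , below)
  ... | inj₁ none with P? n
  ...   | yes pn = inj₂ (n , pn , ≤-refl , none)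
  ...   | no ¬pn = inj₁ below
    where
    below : ∀ j → j < suc n → ¬ P j
    below j j<1+n with m≤n⇒m<n∨m≡n (s≤s⁻¹ j<1+n)
    ... | inj₁ j<n = none j j<n
    ... | inj₂ refl = ¬pn
... | inj₁ none = ⊥-elim (none n ≤-refl pn)
... | inj₂ (m , pm , m<1+n , below) = m , pm , s≤s⁻¹ m<1+n , below

ForwardSteps : ∀ {A : Set} → (A → A) → (A → Color) → Set
ForwardSteps τ lab = ∀ x → lab (τ x) ≡ lab x ⊎ lab (τ x) ≡ next (lab x)

changed : Color → Color → ℕ
changed a b = 𝟙 (¬? (b ≟ a))

changed-same : ∀ {a b} → b ≡ a → changed a b ≡ 0
changed-same {a} {b} b≡a = 𝟙-no (¬? (b ≟ a)) (λ b≢a → b≢a b≡a)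

changed-next : ∀ {a b} → b ≡ next a → changed a b ≡ 1
changed-next {a} {b} b≡next-a = 𝟙-yes (¬? (b ≟ a)) (λ b≡a → next≢id a (trans (sym b≡next-a) b≡a))

labelChange : ∀ {A : Set} → (A → A) → (A → Color) → A → ℕ
labelChange τ lab x = changed (lab x) (lab (τ x))

ThreeBlocks : (ℕ → Color) → ℕ → ℕ → ℕ → Set
ThreeBlocks u k₁ k₂ p =
  0 < k₁ × k₁ < k₂ × k₂ < p ×
  (∀ j → j < k₁ → u j ≡ c0) ×
  (∀ j → k₁ ≤ j → j < k₂ → u j ≡ c1) ×
  (∀ j → k₂ ≤ j → j < p → u j ≡ c2)

module ColourWalk (s : ℕ → Color) (step : ForwardSteps suc s) where

  change : ℕ → ℕ
  change = labelChange suc s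

  height : ℕ → ℕ
  height j = ∑< j change

  colour≡height : ∀ j → s j ≡ iter next (height j) (s 0)
  colour≡height zero = refl
  colour≡height (suc j) with step j
  ... | inj₁ same = begin
    s (suc j)                                  ≡⟨ trans same (colour≡height j) ⟩
    iter next (height j) (s 0)                 ≡⟨ cong (λ k → iter next k (s 0)) (sym (+-identityʳ (height j))) ⟩
    iter next (height j + 0) (s 0)             ≡⟨ cong (λ c → iter next (height j + c) (s 0)) (sym (changed-same same)) ⟩
    iter next (height j + change j) (s 0)      ≡⟨ cong (λ k → iter next k (s 0)) (sym (∑<-suc j change)) ⟩
    iter next (height (suc j)) (s 0)           ∎
    where open ≡-Reasoning
  ... | inj₂ moved = begin
    s (suc j)                                  ≡⟨ trans moved (cong next (colour≡height j)) ⟩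
    iter next (1 + height j) (s 0)             ≡⟨ cong (λ k → iter next k (s 0)) (+-comm 1 (height j)) ⟩
    iter next (height j + 1) (s 0)             ≡⟨ cong (λ c → iter next (height j + c) (s 0)) (sym (changed-next moved)) ⟩
    iter next (height j + change j) (s 0)      ≡⟨ cong (λ k → iter next k (s 0)) (sym (∑<-suc j change)) ⟩
    iter next (height (suc j)) (s 0)           ∎
    where open ≡-Reasoning

  closed-walk-changes≥3 : ∀ p → s p ≡ s 0 → height p ≢ 0 → 3 ≤ height p
  closed-walk-changes≥3 p closed h≢0 with height p | colour≡height p
  ... | zero | _ = ⊥-elim (h≢0 refl)
  ... | 1 | sp≡ = ⊥-elim (next≢id (s 0) (trans (sym sp≡) closed))
  ... | 2 | sp≡ = ⊥-elim (next²≢id (s 0) (trans (sym sp≡) closed))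
  ... | suc (suc (suc _)) | _ = s≤s (s≤s (s≤s z≤n))

  Leaves : Color → ℕ → Set
  Leaves x c = s c ≡ x × s (suc c) ≡ next x

  leaves-before-changing : ∀ {x a b} → a ≤ b → s a ≡ x → s b ≢ x → Σ ℕ λ c → a ≤ c × c < b × Leaves x c
  leaves-before-changing {x} {a} {zero} z≤n sa≡x sb≢x = ⊥-elim (sb≢x sa≡x)
  leaves-before-changing {x} {a} {suc b} a≤1+b sa≡x sb≢x with m≤n⇒m<n∨m≡n a≤1+b
  ... | inj₂ refl = ⊥-elim (sb≢x sa≡x)
  ... | inj₁ a<1+b with s b ≟ x
  ...   | no sb'≢x = let c , a≤c , c<b , leaves = leaves-before-changing (s≤s⁻¹ a<1+b) sa≡x sb'≢x
                     in c , a≤c , m<n⇒m<1+n c<b , leaves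
  ...   | yes sb'≡x with step b
  ...     | inj₁ same = ⊥-elim (sb≢x (trans same sb'≡x))
  ...     | inj₂ moved = b , s≤s⁻¹ a<1+b , ≤-refl , sb'≡x , trans moved (cong next sb'≡x)

  -- the height climbs from 0 to 2 in steps of at most one, so it is 0, then 1, then 2
  module FromC0 (q : ℕ) (s0≡c0 : s 0 ≡ c0) (sq≡c2 : s q ≡ c2) (sq+1≡c0 : s (suc q) ≡ c0)
    (three : height (suc q) ≡ 3) where

    colour≡ : ∀ {j k} → height j ≡ k → s j ≡ iter next k c0
    colour≡ {j} hj≡k = trans (colour≡height j) (cong₂ (iter next) hj≡k s0≡c0)

    height-q : height q ≡ 2
    height-q = +-cancelʳ-≡ 1 (height q) 2 (begin
      height q + 1          ≡⟨ cong (height q +_) (changed-next (trans sq+1≡c0 (cong next (sym sq≡c2)))) ⟨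
      height q + change q   ≡⟨ ∑<-suc q change ⟨
      height (suc q)        ≡⟨ three ⟩
      3                     ∎)
      where open ≡-Reasoning

    height-mono : ∀ {i j} → i ≤ j → height i ≤ height j
    height-mono = ∑<-mono-≤ change

    height-step : ∀ k → height (suc k) ≤ suc (height k)
    height-step k = begin
      height (suc k)          ≡⟨ ∑<-suc k change ⟩
      height k + change k     ≤⟨ +-monoʳ-≤ (height k) (𝟙≤1 _) ⟩
      height k + 1            ≡⟨ +-comm (height k) 1 ⟩
      suc (height k)          ∎
      where open ≤-Reasoning

    height≥1⇒0< : ∀ {k} → 1 ≤ height k → 0 < k
    height≥1⇒0< {suc k} _ = s≤s z≤n

    height≥2-after-height≥1 : ∀ {k₁ k₂} → (∀ j → j < k₁ → ¬ 1 ≤ height j) → 2 ≤ height k₂ → k₁ < k₂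
    height≥2-after-height≥1 {k₂ = suc k} below-k₁ 2≤height =
      s≤s (≮⇒≥ λ k<k₁ → below-k₁ k k<k₁ (s≤s⁻¹ (≤-trans 2≤height (height-step k))))

    three-blocks-from-c0 : Σ ℕ λ k₁ → Σ ℕ λ k₂ → ThreeBlocks s k₁ k₂ (suc q)
    three-blocks-from-c0
      with least-witness (λ j → 1 ≤ height j) (λ j → 1 ≤? height j) {q} (≤-trans (s≤s z≤n) (≤-reflexive (sym height-q)))
         | least-witness (λ j → 2 ≤ height j) (λ j → 2 ≤? height j) {q} (≤-reflexive (sym height-q))
    ... | k₁ , 1≤height-k₁ , _ , below-k₁ | k₂ , 2≤height-k₂ , k₂≤q , below-k₂ =
        k₁ , k₂ , height≥1⇒0< 1≤height-k₁ , height≥2-after-height≥1 below-k₁ 2≤height-k₂ , s≤s k₂≤q ,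
        block₀ , block₁ , block₂
      where
      block₀ : ∀ j → j < k₁ → s j ≡ c0
      block₀ j j<k₁ = colour≡ (n<1⇒n≡0 (≰⇒> (below-k₁ j j<k₁)))

      block₁ : ∀ j → k₁ ≤ j → j < k₂ → s j ≡ c1
      block₁ j k₁≤j j<k₂ = colour≡ (≤-antisym (s≤s⁻¹ (≰⇒> (below-k₂ j j<k₂))) (≤-trans 1≤height-k₁ (height-mono k₁≤j)))

      block₂ : ∀ j → k₂ ≤ j → j < suc q → s j ≡ c2
      block₂ j k₂≤j j<1+q = colour≡ (≤-antisym (≤-trans (height-mono (s≤s⁻¹ j<1+q)) (≤-reflexive height-q))
                                               (≤-trans 2≤height-k₂ (height-mono k₂≤j)))

module PeriodicColourWalk (s : ℕ → Color) (step : ForwardSteps suc s)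
  (q : ℕ) (periodic : ∀ j → s (j + suc q) ≡ s j) where
  open ColourWalk s step

  leaves-next : ∀ {x} → Σ ℕ (Leaves x) → Σ ℕ (Leaves (next x))
  leaves-next {x} (j , sj≡x , sj+1≡next-x) =
    let c , _ , _ , leaves = leaves-before-changing (m<m+n j (s≤s z≤n)) sj+1≡next-x
                               (λ eq → next≢id x (trans (sym eq) (trans (periodic j) sj≡x)))
    in c , leaves

  leaves-c2 : height (suc q) ≢ 0 → Σ ℕ (Leaves c2)
  leaves-c2 h≢0 with ∑<≢0⇒ (suc q) change h≢0
  ... | j , _ , changed with step j
  ...   | inj₁ same = ⊥-elim (changed (changed-same same))
  ...   | inj₂ moved = to-c2 (s j) (j , refl , moved)
    where
    to-c2 : ∀ x → Σ ℕ (Leaves x) → Σ ℕ (Leaves c2)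
    to-c2 F.zero l = leaves-next (leaves-next l)
    to-c2 (F.suc F.zero) l = leaves-next l
    to-c2 (F.suc (F.suc F.zero)) l = l

  -- start the walk right after a step from c2 to c0
  three-blocks : height (suc q) ≡ 3 → Σ ℕ λ m → Σ ℕ λ k₁ → Σ ℕ λ k₂ → ThreeBlocks (λ j → s (j + m)) k₁ k₂ (suc q)
  three-blocks three with leaves-c2 (λ h≡0 → 0≢1+n (trans (sym h≡0) three))
  ... | m , sm≡c2 , sm+1≡c0 = suc m , ColourWalk.FromC0.three-blocks-from-c0 u (λ j → step (j + suc m)) q
          sm+1≡c0 uq≡c2 (trans (cong s (+-comm (suc q) (suc m))) (trans (periodic (suc m)) sm+1≡c0))
          (trans (∑<-rotate (suc q) change change-periodic (suc m)) three)
    where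
    u : ℕ → Color
    u j = s (j + suc m)
    uq≡c2 : u q ≡ c2
    uq≡c2 = trans (cong s (trans (+-suc q m) (+-comm (suc q) m))) (trans (periodic m) sm≡c2)
    change-periodic : ∀ j → change (j + suc q) ≡ change j
    change-periodic j = cong₂ changed (periodic j) (periodic (suc j))

iter-+ : ∀ {A : Set} (f : A → A) a b x → iter f a (iter f b x) ≡ iter f (a + b) x
iter-+ f zero b x = refl
iter-+ f (suc a) b x = cong f (iter-+ f a b x)

iter-comm : ∀ {A : Set} (f : A → A) a b x → iter f a (iter f b x) ≡ iter f b (iter f a x)
iter-comm f a b x = trans (iter-+ f a b x) (trans (cong (λ k → iter f k x) (+-comm a b)) (sym (iter-+ f b a x)))

iter-inverse : ∀ {A : Set} (f g : A → A) → (∀ x → g (f x) ≡ x) → ∀ k x → iter g k (iter f k x) ≡ x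
iter-inverse f g g∘f zero x = refl
iter-inverse f g g∘f (suc k) x = begin
  g (iter g k (f (iter f k x)))   ≡⟨ iter-comm g k 1 (f (iter f k x)) ⟨
  iter g k (g (f (iter f k x)))   ≡⟨ cong (iter g k) (g∘f (iter f k x)) ⟩
  iter g k (iter f k x)           ≡⟨ iter-inverse f g g∘f k x ⟩
  x                               ∎
  where open ≡-Reasoning

length-filter-tabulate : ∀ {n} {A : Set} {P : A → Set} (P? : Decidable P) (f : Fin n → A) →
  length (filter P? (tabulate f)) ≡ sum (λ i → 𝟙 (P? (f i)))
length-filter-tabulate {zero} P? f = refl
length-filter-tabulate {suc n} P? f with P? (f F.zero)
... | yes _ = cong suc (length-filter-tabulate P? (f ∘ F.suc))
... | no _ = length-filter-tabulate P? (f ∘ F.suc)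

minimal⇒Rep : ∀ {n} (f : Fin n → Fin n) {r} → (∀ y → SameOrbit f r y → toℕ r ≤ toℕ y) → IsOrbitRep f r
minimal⇒Rep f minimal k = minimal _ (toℕ k , refl)

module Orbits {n : ℕ} (τ τ⁻ : Fin n → Fin n) (τ⁻∘τ : ∀ x → τ⁻ (τ x) ≡ x) where

  iter-cancel : ∀ m {a b} → iter τ m a ≡ iter τ m b → a ≡ b
  iter-cancel zero eq = eq
  iter-cancel (suc m) eq = iter-cancel m (trans (sym (τ⁻∘τ _)) (trans (cong τ⁻ eq) (τ⁻∘τ _)))

  iter-shift : ∀ x {i j} → i ≤ j → iter τ i x ≡ iter τ j x → iter τ (j ∸ i) x ≡ x
  iter-shift x {i} {j} i≤j eq = sym (iter-cancel i (begin
    iter τ i x                          ≡⟨ eq ⟩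
    iter τ j x                          ≡⟨ cong (λ k → iter τ k x) (sym (m∸n+n≡m i≤j)) ⟩
    iter τ (j ∸ i + i) x                ≡⟨ sym (iter-+ τ (j ∸ i) i x) ⟩
    iter τ (j ∸ i) (iter τ i x)         ≡⟨ iter-comm τ (j ∸ i) i x ⟩
    iter τ i (iter τ (j ∸ i) x)         ∎))
    where open ≡-Reasoning

  record Period (x : Fin n) : Set where
    field
      q       : ℕ
      q<n     : q < n
      returns : iter τ (suc q) x ≡ x
      minimal : ∀ j → 0 < j → j < suc q → iter τ j x ≢ x

  -- by pigeonhole two of x, τ x, …, τⁿ x coincide
  abstract
    period-of : ∀ x → Period x
    period-of x with FP.pigeonhole (n<1+n n) (λ (i : Fin (suc n)) → iter τ (toℕ i) x)
    ... | i , j , i<j , eq with least-witness (λ k → 0 < k × iter τ k x ≡ x)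
                                  (λ k → (0 <? k) ×-dec (iter τ k x ≟ x)) {toℕ j ∸ toℕ i}
                                  (m<n⇒0<n∸m i<j , iter-shift x (<⇒≤ i<j) eq)
    ... | suc q , (_ , returns) , q<j-i , below = record
      { q = q
      ; q<n = <-≤-trans q<j-i (≤-trans (m∸n≤m (toℕ j) (toℕ i)) (s≤s⁻¹ (toℕ<n j)))
      ; returns = returns
      ; minimal = λ k 0<k k<q+1 → curry (below k k<q+1) 0<k
      }

  period : Fin n → ℕ
  period x = suc (Period.q (period-of x))

  period-returns : ∀ x → iter τ (period x) x ≡ x
  period-returns x = Period.returns (period-of x)

  iter-periodic : ∀ x j → iter τ (j + period x) x ≡ iter τ j x
  iter-periodic x j = trans (sym (iter-+ τ j (period x) x)) (cong (iter τ j) (period-returns x))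

  iter-reduce : ∀ x k → Σ ℕ λ j → j < period x × iter τ k x ≡ iter τ j x
  iter-reduce x zero = 0 , s≤s z≤n , refl
  iter-reduce x (suc k) with iter-reduce x k
  ... | j , j<p , eq with m≤n⇒m<n∨m≡n j<p
  ...   | inj₁ j+1<p = suc j , j+1<p , cong τ eq
  ...   | inj₂ j+1≡p = 0 , s≤s z≤n , trans (cong τ eq) (trans (cong (λ k → iter τ k x) j+1≡p) (period-returns x))

  iter-distinct : ∀ x {i j} → i < j → j < period x → iter τ i x ≢ iter τ j x
  iter-distinct x {i} {j} i<j j<p eq = Period.minimal (period-of x) (j ∸ i) (m<n⇒0<n∸m i<j)
    (≤-<-trans (m∸n≤m j i) j<p) (iter-shift x (<⇒≤ i<j) eq)

  iter-injective : ∀ x {i j} → i < period x → j < period x → iter τ i x ≡ iter τ j x → i ≡ j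
  iter-injective x {i} {j} i<p j<p eq with <-cmp i j
  ... | tri< i<j _ _ = ⊥-elim (iter-distinct x i<j j<p eq)
  ... | tri≈ _ i≡j _ = i≡j
  ... | tri> _ _ j<i = ⊥-elim (iter-distinct x j<i i<p (sym eq))

  orbit-refl : ∀ x → SameOrbit τ x x
  orbit-refl x = 0 , refl

  orbit-trans : ∀ {x y z} → SameOrbit τ x y → SameOrbit τ y z → SameOrbit τ x z
  orbit-trans {x} (a , refl) (b , refl) = b + a , sym (iter-+ τ b a x)

  orbit-within-period : ∀ {x y} → SameOrbit τ x y → Σ ℕ λ j → j < period x × iter τ j x ≡ y
  orbit-within-period {x} (k , eq) = let j , j<p , eq′ = iter-reduce x k in j , j<p , trans (sym eq′) eq

  orbit-sym : ∀ {x y} → SameOrbit τ x y → SameOrbit τ y x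
  orbit-sym {x} so with orbit-within-period so
  ... | j , j<p , refl = period x ∸ j , (begin
    iter τ (period x ∸ j) (iter τ j x)   ≡⟨ iter-+ τ (period x ∸ j) j x ⟩
    iter τ (period x ∸ j + j) x          ≡⟨ cong (λ k → iter τ k x) (m∸n+n≡m (<⇒≤ j<p)) ⟩
    iter τ (period x) x                  ≡⟨ period-returns x ⟩
    x                                    ∎)
    where open ≡-Reasoning

  orbit-first-arrival : ∀ {x y} → SameOrbit τ x y → Σ ℕ λ l → iter τ l x ≡ y × (∀ j → j < l → iter τ j x ≢ y)
  orbit-first-arrival {x} {y} (k , eq) =
    let l , arrives , _ , before = least-witness (λ l → iter τ l x ≡ y) (λ l → iter τ l x ≟ y) {k} eq
    in l , arrives , before

  sameOrbit? : ∀ x y → Dec (SameOrbit τ x y)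
  sameOrbit? x y = map′ (λ (j , eq) → toℕ j , eq) within
    (FP.any? (λ (j : Fin (period x)) → iter τ (toℕ j) x ≟ y))
    where
    within : SameOrbit τ x y → Σ (Fin (period x)) λ j → iter τ (toℕ j) x ≡ y
    within so = let j , j<p , eq = orbit-within-period so
                in fromℕ< j<p , trans (cong (λ k → iter τ k x) (toℕ-fromℕ< j<p)) eq

  orbitSum : (Fin n → ℕ) → Fin n → ℕ
  orbitSum h x = ∑< (period x) (λ j → h (iter τ j x))

  orbit-occurrences : ∀ x y → ∑< (period x) (λ j → 𝟙 (iter τ j x ≟ y)) ≡ 𝟙 (sameOrbit? x y)
  orbit-occurrences x y with sameOrbit? x y
  ... | no ¬so = sum-zero {period x} _ (λ j → 𝟙-no (iter τ (toℕ j) x ≟ y) (λ eq → ¬so (toℕ j , eq)))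
  ... | yes so with orbit-within-period so
  ...   | j , j<p , eq = trans (sum-single {period x} _ (fromℕ< j<p) (λ i i≢j → 𝟙-no (iter τ (toℕ i) x ≟ y)
            (λ eq′ → i≢j (FP.toℕ-injective (trans (iter-injective x (toℕ<n i) j<p (trans eq′ (sym eq)))
                                                   (sym (toℕ-fromℕ< j<p)))))))
          (𝟙-yes (iter τ (toℕ (fromℕ< j<p)) x ≟ y) (trans (cong (λ k → iter τ k x) (toℕ-fromℕ< j<p)) eq))

  orbitSum≡sum : ∀ h x → orbitSum h x ≡ sum (λ y → 𝟙 (sameOrbit? x y) * h y)
  orbitSum≡sum h x = begin
    ∑< (period x) (λ j → h (iter τ j x))                              ≡⟨ ∑<-cong (period x) (λ j _ → sym (sum-select (iter τ j x) h)) ⟩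
    ∑< (period x) (λ j → sum (λ y → 𝟙 (iter τ j x ≟ y) * h y))        ≡⟨ ∑-comm {period x} (λ j y → 𝟙 (iter τ (toℕ j) x ≟ y) * h y) ⟩
    sum (λ y → ∑< (period x) (λ j → 𝟙 (iter τ j x ≟ y) * h y))        ≡⟨ sum-cong-≗ (λ y → sym (*-distribʳ-sum {period x} (h y) (λ j → 𝟙 (iter τ (toℕ j) x ≟ y)))) ⟩
    sum (λ y → ∑< (period x) (λ j → 𝟙 (iter τ j x ≟ y)) * h y)        ≡⟨ sum-cong-≗ (λ y → cong (_* h y) (orbit-occurrences x y)) ⟩
    sum (λ y → 𝟙 (sameOrbit? x y) * h y)                              ∎
    where open ≡-Reasoning

  Rep⇒minimal : ∀ {r y} → IsOrbitRep τ r → SameOrbit τ r y → toℕ r ≤ toℕ y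
  Rep⇒minimal {r} rep so with orbit-within-period so
  ... | j , j<p , refl = subst (λ k → toℕ r ≤ toℕ (iter τ k r)) (toℕ-fromℕ< j<n) (rep (fromℕ< j<n))
    where
    j<n : j < n
    j<n = ≤-trans j<p (Period.q<n (period-of r))

  rep-exists : ∀ d → Σ (Fin n) λ r → IsOrbitRep τ r × SameOrbit τ r d
  rep-exists d with least-witness (λ v → Σ (Fin (period d)) λ j → toℕ (iter τ (toℕ j) d) ≡ v)
                     (λ v → FP.any? (λ j → toℕ (iter τ (toℕ j) d) ≟ℕ v)) {toℕ d} (F.zero , refl)
  ... | _ , (j , refl) , _ , below = iter τ (toℕ j) d , minimal⇒Rep τ minimal , orbit-sym (toℕ j , refl)
    where
    minimal : ∀ y → SameOrbit τ (iter τ (toℕ j) d) y → toℕ (iter τ (toℕ j) d) ≤ toℕ y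
    minimal y so with orbit-within-period (orbit-trans (toℕ j , refl) so)
    ... | i , i<p , refl = ≮⇒≥ λ smaller →
      below _ smaller (fromℕ< i<p , cong (λ k → toℕ (iter τ k d)) (toℕ-fromℕ< i<p))

  rep-unique : ∀ {r r′ d} → IsOrbitRep τ r → IsOrbitRep τ r′ → SameOrbit τ r d → SameOrbit τ r′ d → r ≡ r′
  rep-unique rep rep′ so so′ = FP.toℕ-injective (≤-antisym
    (Rep⇒minimal rep (orbit-trans so (orbit-sym so′))) (Rep⇒minimal rep′ (orbit-trans so′ (orbit-sym so))))

  Rep⇒Rep-inverse : (∀ x → τ (τ⁻ x) ≡ x) → ∀ {r} → IsOrbitRep τ r → IsOrbitRep τ⁻ r
  Rep⇒Rep-inverse τ∘τ⁻ {r} rep = minimal⇒Rep τ⁻ λ y (k , eq) →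
    Rep⇒minimal rep (orbit-sym (k , trans (cong (iter τ k) (sym eq)) (iter-inverse τ⁻ τ τ∘τ⁻ k r)))

  isRep : Fin n → ℕ
  isRep r = 𝟙 (isOrbitRep? τ r)

  numOrbits≡sum-isRep : numOrbits τ ≡ sum isRep
  numOrbits≡sum-isRep = length-filter-tabulate (isOrbitRep? τ) (λ i → i)

  one-rep-per-orbit : ∀ y → sum (λ r → isRep r * 𝟙 (sameOrbit? r y)) ≡ 1
  one-rep-per-orbit y with rep-exists y
  ... | r₀ , rep₀ , so₀ = trans (sum-single _ r₀ other-reps-vanish)
                            (cong₂ _*_ (𝟙-yes (isOrbitRep? τ r₀) rep₀) (𝟙-yes (sameOrbit? r₀ y) so₀))
    where
    other-reps-vanish : ∀ r → r ≢ r₀ → isRep r * 𝟙 (sameOrbit? r y) ≡ 0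
    other-reps-vanish r r≢r₀ with isOrbitRep? τ r | sameOrbit? r y
    ... | no _ | _ = refl
    ... | yes _ | no _ = refl
    ... | yes rep | yes so = ⊥-elim (r≢r₀ (rep-unique rep rep₀ so so₀))

  sum≡sum-orbitSums : ∀ h → sum h ≡ sum (λ r → isRep r * orbitSum h r)
  sum≡sum-orbitSums h = sym (begin
    sum (λ r → isRep r * orbitSum h r)                              ≡⟨ sum-cong-≗ (λ r → cong (isRep r *_) (orbitSum≡sum h r)) ⟩
    sum (λ r → isRep r * sum (λ y → 𝟙 (sameOrbit? r y) * h y))      ≡⟨ sum-cong-≗ (λ r → *-distribˡ-sum {n} (isRep r) _) ⟩
    sum (λ r → sum (λ y → isRep r * (𝟙 (sameOrbit? r y) * h y)))    ≡⟨ ∑-comm (λ r y → isRep r * (𝟙 (sameOrbit? r y) * h y)) ⟩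
    sum (λ y → sum (λ r → isRep r * (𝟙 (sameOrbit? r y) * h y)))    ≡⟨ sum-cong-≗ (λ y → sum-cong-≗ (λ r → sym (*-assoc (isRep r) _ (h y)))) ⟩
    sum (λ y → sum (λ r → isRep r * 𝟙 (sameOrbit? r y) * h y))      ≡⟨ sum-cong-≗ (λ y → sym (*-distribʳ-sum {n} (h y) _)) ⟩
    sum (λ y → sum (λ r → isRep r * 𝟙 (sameOrbit? r y)) * h y)      ≡⟨ sum-cong-≗ (λ y → cong (_* h y) (one-rep-per-orbit y)) ⟩
    sum (λ y → 1 * h y)                                             ≡⟨ sum-cong-≗ (λ y → *-identityˡ (h y)) ⟩
    sum h                                                           ∎)
    where open ≡-Reasoning

  sum-isRep-scaled : ∀ c → sum (λ r → isRep r * c) ≡ c * numOrbits τ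
  sum-isRep-scaled c = begin
    sum (λ r → isRep r * c)   ≡⟨ sum-cong-≗ (λ r → *-comm (isRep r) c) ⟩
    sum (λ r → c * isRep r)   ≡⟨ *-distribˡ-sum c isRep ⟨
    c * sum isRep             ≡⟨ cong (c *_) numOrbits≡sum-isRep ⟨
    c * numOrbits τ           ∎
    where open ≡-Reasoning

  sum≡orbitSum*numOrbits : ∀ h c → (∀ r → orbitSum h r ≡ c) → sum h ≡ c * numOrbits τ
  sum≡orbitSum*numOrbits h c constant = begin
    sum h                                 ≡⟨ sum≡sum-orbitSums h ⟩
    sum (λ r → isRep r * orbitSum h r)    ≡⟨ sum-cong-≗ (λ r → cong (isRep r *_) (constant r)) ⟩
    sum (λ r → isRep r * c)               ≡⟨ sum-isRep-scaled c ⟩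
    c * numOrbits τ                       ∎
    where open ≡-Reasoning

  orbitSums-tight : ∀ h c → (∀ r → c ≤ orbitSum h r) → sum h ≡ c * numOrbits τ →
    ∀ r → IsOrbitRep τ r → orbitSum h r ≡ c
  orbitSums-tight h c c≤ total r rep = begin
    orbitSum h r                  ≡⟨ *-identityˡ (orbitSum h r) ⟨
    1 * orbitSum h r              ≡⟨ cong (_* orbitSum h r) isRep-r ⟨
    isRep r * orbitSum h r        ≡⟨ sum-mono-≤-≡⇒≗ (λ r → *-monoʳ-≤ (isRep r) (c≤ r)) totals r ⟨
    isRep r * c                   ≡⟨ cong (_* c) isRep-r ⟩
    1 * c                         ≡⟨ *-identityˡ c ⟩
    c                             ∎
    where
    open ≡-Reasoning
    isRep-r : isRep r ≡ 1
    isRep-r = 𝟙-yes (isOrbitRep? τ r) rep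
    totals : sum (λ r → isRep r * c) ≡ sum (λ r → isRep r * orbitSum h r)
    totals = trans (sum-isRep-scaled c) (trans (sym total) (sum≡sum-orbitSums h))

  blocks-along-orbit : (lab : Fin n → Color) → ForwardSteps τ lab →
    ∀ r → orbitSum (labelChange τ lab) r ≡ 3 →
    Σ ℕ λ m → Σ ℕ λ k₁ → Σ ℕ λ k₂ → ThreeBlocks (λ j → lab (iter τ (j + m) r)) k₁ k₂ (period r)
  blocks-along-orbit lab step r three = PeriodicColourWalk.three-blocks (λ j → lab (iter τ j r)) (λ j → step (iter τ j r))
           (Period.q (period-of r)) (λ j → cong lab (iter-periodic r j)) three

  blocks⇒three-intervals : (lab : Fin n → Color) → ∀ r m {k₁ k₂} →
    ThreeBlocks (λ j → lab (iter τ (j + m) r)) k₁ k₂ (period r) → ∀ d → SameOrbit τ r d → ThreeIntervals τ lab d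
  blocks⇒three-intervals lab r m {k₁} {k₂} (0<k₁ , k₁<k₂ , k₂<p , block₀ , block₁ , block₂) d so =
      iter τ m r , orbit-trans (orbit-sym so) (m , refl) ,
      period r , k₁ , k₂ , 0<k₁ , k₁<k₂ , k₂<p , returns , minimal ,
      (λ j j<k₁ → trans (shift j) (block₀ j j<k₁)) ,
      (λ j k₁≤j j<k₂ → trans (shift j) (block₁ j k₁≤j j<k₂)) ,
      (λ j k₂≤j j<p → trans (shift j) (block₂ j k₂≤j j<p))
    where
    shift : ∀ j → lab (iter τ j (iter τ m r)) ≡ lab (iter τ (j + m) r)
    shift j = cong lab (iter-+ τ j m r)
    returns : iter τ (period r) (iter τ m r) ≡ iter τ m r
    returns = trans (iter-comm τ (period r) m r) (cong (iter τ m) (period-returns r))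
    minimal : ∀ j → 0 < j → j < period r → iter τ j (iter τ m r) ≢ iter τ m r
    minimal j 0<j j<p eq = Period.minimal (period-of r) j 0<j j<p (iter-cancel m (trans (iter-comm τ m j r) eq))

  three-changes⇒three-intervals : (lab : Fin n → Color) → ForwardSteps τ lab →
    ∀ r → orbitSum (labelChange τ lab) r ≡ 3 → ∀ d → SameOrbit τ r d → ThreeIntervals τ lab d
  three-changes⇒three-intervals lab step r three =
    let m , _ , _ , blocks = blocks-along-orbit lab step r three in blocks⇒three-intervals lab r m blocks

numOrbits-inverse : ∀ {n} (τ τ⁻ : Fin n → Fin n) → (∀ x → τ⁻ (τ x) ≡ x) → (∀ x → τ (τ⁻ x) ≡ x) →
  numOrbits τ⁻ ≡ numOrbits τ
numOrbits-inverse τ τ⁻ τ⁻∘τ τ∘τ⁻ = begin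
  numOrbits τ⁻     ≡⟨ O⁻.numOrbits≡sum-isRep ⟩
  sum O⁻.isRep     ≡⟨ sum-cong-≗ (λ r → 𝟙-cong-⇔ (isOrbitRep? τ⁻ r) (isOrbitRep? τ r)
                        (O⁻.Rep⇒Rep-inverse τ⁻∘τ) (O.Rep⇒Rep-inverse τ∘τ⁻)) ⟩
  sum O.isRep      ≡⟨ O.numOrbits≡sum-isRep ⟨
  numOrbits τ      ∎
  where
  open ≡-Reasoning
  module O = Orbits τ τ⁻ τ⁻∘τ
  module O⁻ = Orbits τ⁻ τ τ∘τ⁻

-- Labels around an edge, which is seen from its dart x through the pair (out x, out (α x))

data EdgeOrientation : Maybe Color → Maybe Color → Set where
  outward      : ∀ i → EdgeOrientation (just i) nothing
  inward       : ∀ i → EdgeOrientation nothing (just i)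
  two-way-next : ∀ i → EdgeOrientation (just i) (just (next i))
  two-way-prev : ∀ i → EdgeOrientation (just i) (just (prev i))

𝟙-just : Maybe Color → ℕ
𝟙-just (just _) = 1
𝟙-just nothing = 0

-- the labels of the angles just after and just before a dart (junk for an unoriented edge)
labelAfter : Maybe Color → Maybe Color → Color
labelAfter (just i) _ = prev i
labelAfter nothing (just i) = i
labelAfter nothing nothing = c0

labelBefore : Maybe Color → Maybe Color → Color
labelBefore (just i) _ = next i
labelBefore nothing (just i) = i
labelBefore nothing nothing = c0

vertex-step : ∀ {m₁ m₂} → EdgeOrientation m₁ m₂ →
  labelAfter m₁ m₂ ≡ labelBefore m₁ m₂ ⊎ labelAfter m₁ m₂ ≡ next (labelBefore m₁ m₂)
vertex-step (outward i) = inj₂ (sym (next∘next i))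
vertex-step (inward i) = inj₁ refl
vertex-step (two-way-next i) = inj₂ (sym (next∘next i))
vertex-step (two-way-prev i) = inj₂ (sym (next∘next i))

vertex-changed : ∀ {m₁ m₂} → EdgeOrientation m₁ m₂ → changed (labelBefore m₁ m₂) (labelAfter m₁ m₂) ≡ 𝟙-just m₁
vertex-changed (outward i) = changed-next (sym (next∘next i))
vertex-changed (inward i) = changed-same refl
vertex-changed (two-way-next i) = changed-next (sym (next∘next i))
vertex-changed (two-way-prev i) = changed-next (sym (next∘next i))

-- along a face the dart x is followed by σ⁻ (α x), whose preceding angle is labelBefore m₂ m₁
face-step : ∀ {m₁ m₂} → EdgeOrientation m₁ m₂ →
  labelBefore m₂ m₁ ≡ labelAfter m₁ m₂ ⊎ labelBefore m₂ m₁ ≡ next (labelAfter m₁ m₂)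
face-step (outward i) = inj₂ (sym (next∘prev i))
face-step (inward i) = inj₂ refl
face-step (two-way-next i) = inj₁ (next∘next i)
face-step (two-way-prev i) = inj₂ refl

face-unchanged⇒two-way : ∀ {m₁ m₂} → EdgeOrientation m₁ m₂ → labelBefore m₂ m₁ ≡ labelAfter m₁ m₂ →
  m₁ ≡ just (next (labelAfter m₁ m₂)) × m₂ ≡ just (prev (labelAfter m₁ m₂))
face-unchanged⇒two-way (outward i) i≡prev-i = ⊥-elim (prev≢id i (sym i≡prev-i))
face-unchanged⇒two-way (inward i) next-i≡i = ⊥-elim (next≢id i next-i≡i)
face-unchanged⇒two-way (two-way-next i) _ = cong just (sym (next∘prev i)) , cong just (sym (prev∘prev i))
face-unchanged⇒two-way (two-way-prev i) next-prev-i≡prev-i =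
  ⊥-elim (prev≢id i (sym (trans (sym (next∘prev i)) next-prev-i≡prev-i)))

edge-count : ∀ {m₁ m₂} → EdgeOrientation m₁ m₂ →
  changed (labelAfter m₁ m₂) (labelBefore m₂ m₁) + changed (labelAfter m₂ m₁) (labelBefore m₁ m₂)
    + (𝟙-just m₁ + 𝟙-just m₂) ≡ 3
edge-count (outward i) =
  cong₂ _+_ (cong₂ _+_ (changed-next {prev i} {i} (sym (next∘prev i))) (changed-next {i} refl)) refl
edge-count (inward i) =
  cong₂ _+_ (cong₂ _+_ (changed-next {i} refl) (changed-next {prev i} {i} (sym (next∘prev i)))) refl
edge-count (two-way-next i) =
  cong₂ _+_ (cong₂ _+_ (changed-same {prev i} (next∘next i))
                       (changed-next {prev (next i)} (cong next (sym (prev∘next i))))) refl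
edge-count (two-way-prev i) =
  cong₂ _+_ (cong₂ _+_ (changed-next {prev i} refl) (changed-same {prev (prev i)} (sym (prev∘prev i)))) refl

module AngleLabeling (M : ToroidalMap) (W : SchnyderWood M) (lab : Fin (ToroidalMap.D M) → Color)
  (labeling : IsAngleLabeling M W lab) where
  open ToroidalMap M
  open SchnyderWood W

  module Vertices = Orbits σ σ⁻ σ⁻σ

  σ⁻-same-vertex : ∀ d → SameVertex M (σ⁻ d) d
  σ⁻-same-vertex d = 1 , σσ⁻ d

  distinct-colours⇒≢ : ∀ {x y i j} → out x ≡ just i → out y ≡ just j → i ≢ j → x ≢ y
  distinct-colours⇒≢ out-x out-y i≢j refl = i≢j (just-injective (trans (sym out-x) out-y))

  label-after-outgoing : ∀ {d i} → out d ≡ just i → lab d ≡ prev i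
  label-after-outgoing {d} {i} out-d with outExists d (prev (prev i))
  ... | b , d~b , out-b with Vertices.orbit-first-arrival d~b
  ...   | l , arrives , first =
    labeling d (prev i) d b (Vertices.orbit-refl d) d~b (trans out-d (cong just (sym (next∘prev i)))) out-b
      (l , arrives , first , 0 , z≤n , refl)
      (distinct-colours⇒≢ out-d out-b (λ i≡prev²i → next≢id i (trans (sym (prev∘prev i)) (sym i≡prev²i))))

  label-before-outgoing : ∀ {d i} → out d ≡ just i → lab (σ⁻ d) ≡ next i
  label-before-outgoing {d} {i} out-d with outExists d (next (next i))
  ... | a , d~a , out-a with Vertices.orbit-first-arrival (Vertices.orbit-sym d~a)
  ...   | zero , a≡d , _ = ⊥-elim (distinct-colours⇒≢ out-a out-d (next²≢id i) a≡d)
  ...   | suc l , arrives , first =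
    labeling (σ⁻ d) (next i) a d (Vertices.orbit-trans (σ⁻-same-vertex d) d~a) (σ⁻-same-vertex d)
      out-a (trans out-d (cong just (sym (prev∘next i))))
      (suc l , arrives , first , l , n≤1+n l , σˡa≡σ⁻d)
      (λ σ⁻d≡d → first l ≤-refl (trans σˡa≡σ⁻d σ⁻d≡d))
    where
    σˡa≡σ⁻d : iter σ l a ≡ σ⁻ d
    σˡa≡σ⁻d = trans (sym (σ⁻σ _)) (cong σ⁻ arrives)

  label-around-incoming : ∀ {d i} → out d ≡ nothing → out (α d) ≡ just i → lab d ≡ i × lab (σ⁻ d) ≡ i
  label-around-incoming {d} {i} out-d out-αd with outExists d (next i) | outExists d (prev i)
  ... | a , d~a , out-a | b , d~b , out-b with inSector d i a b d~a d~b out-αd out-a out-b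
  ...   | l , arrives , first , zero , _ , a≡d = ⊥-elim (just≢nothing (trans (sym out-a) (trans (cong out a≡d) out-d)))
    where
    just≢nothing : ∀ {x : Color} → just x ≢ nothing
    just≢nothing ()
  ...   | l , arrives , first , suc k , k<l , σᵏ⁺¹a≡d =
    labeling d i a b d~a d~b out-a out-b (l , arrives , first , suc k , k<l , σᵏ⁺¹a≡d) d≢b ,
    labeling (σ⁻ d) i a b (Vertices.orbit-trans (σ⁻-same-vertex d) d~a) (Vertices.orbit-trans (σ⁻-same-vertex d) d~b) out-a out-b
      (l , arrives , first , k , <⇒≤ k<l , σᵏa≡σ⁻d) (λ σ⁻d≡b → first k k<l (trans σᵏa≡σ⁻d σ⁻d≡b))
    where
    σᵏa≡σ⁻d : iter σ k a ≡ σ⁻ d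
    σᵏa≡σ⁻d = trans (sym (σ⁻σ _)) (cong σ⁻ σᵏ⁺¹a≡d)
    d≢b : d ≢ b
    d≢b refl with trans (sym out-b) out-d
    ... | ()

  unoriented-absurd : ∀ {x} → out x ≡ nothing → out (α x) ≡ nothing → ⊥
  unoriented-absurd {x} out-x out-αx = [ (λ h → h out-x) , (λ h → h out-αx) ]′ (oriented x)

  edge-orientation : ∀ x → EdgeOrientation (out x) (out (α x))
  edge-orientation x with out x in out-x | out (α x) in out-αx
  ... | just i | nothing = outward i
  ... | nothing | just i = inward i
  ... | nothing | nothing = ⊥-elim (unoriented-absurd out-x out-αx)
  ... | just i | just j with ≢⇒next⊎prev i j (biDistinct x i j out-x out-αx)
  ...   | inj₁ refl = two-way-next i
  ...   | inj₂ refl = two-way-prev i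

  lab≡labelAfter : ∀ x → lab x ≡ labelAfter (out x) (out (α x))
  lab≡labelAfter x with out x in out-x | out (α x) in out-αx
  ... | just i | _ = label-after-outgoing out-x
  ... | nothing | just i = proj₁ (label-around-incoming out-x out-αx)
  ... | nothing | nothing = ⊥-elim (unoriented-absurd out-x out-αx)

  lab∘σ⁻≡labelBefore : ∀ x → lab (σ⁻ x) ≡ labelBefore (out x) (out (α x))
  lab∘σ⁻≡labelBefore x with out x in out-x | out (α x) in out-αx
  ... | just i | _ = label-before-outgoing out-x
  ... | nothing | just i = proj₂ (label-around-incoming out-x out-αx)
  ... | nothing | nothing = ⊥-elim (unoriented-absurd out-x out-αx)

  lab≡labelBefore-σ : ∀ d → lab d ≡ labelBefore (out (σ d)) (out (α (σ d)))
  lab≡labelBefore-σ d = trans (cong lab (sym (σ⁻σ d))) (lab∘σ⁻≡labelBefore (σ d))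

  vertex-forward : ForwardSteps σ lab
  vertex-forward d = subst₂ (λ a b → b ≡ a ⊎ b ≡ next a) (sym (lab≡labelBefore-σ d)) (sym (lab≡labelAfter (σ d)))
    (vertex-step (edge-orientation (σ d)))

  outgoing : Fin D → ℕ
  outgoing d = 𝟙-just (out d)

  vertex-labelChange : ∀ d → labelChange σ lab d ≡ outgoing (σ d)
  vertex-labelChange d = trans (cong₂ changed (lab≡labelBefore-σ d) (lab≡labelAfter (σ d)))
    (vertex-changed (edge-orientation (σ d)))

  _≟-out_ : (m m′ : Maybe Color) → Dec (m ≡ m′)
  _≟-out_ = ≡-dec-Maybe _≟_

  𝟙-just≡sum : ∀ m → 𝟙-just m ≡ sum (λ c → 𝟙 (m ≟-out just c))
  𝟙-just≡sum nothing = refl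
  𝟙-just≡sum (just F.zero) = refl
  𝟙-just≡sum (just (F.suc F.zero)) = refl
  𝟙-just≡sum (just (F.suc (F.suc F.zero))) = refl

  -- (T1): outExists r c is the only dart of colour c at the vertex of r
  vertex-colour-δ : ∀ r c y → 𝟙 (Vertices.sameOrbit? r y) * 𝟙 (out y ≟-out just c) ≡ 𝟙 (proj₁ (outExists r c) ≟ y)
  vertex-colour-δ r c y with outExists r c
  ... | e , r~e , out-e = trans (𝟙-* (Vertices.sameOrbit? r y) (out y ≟-out just c))
    (𝟙-cong-⇔ (Vertices.sameOrbit? r y ×-dec (out y ≟-out just c)) (e ≟ y)
      (λ (r~y , out-y) → outUnique e y c (Vertices.orbit-trans (Vertices.orbit-sym r~e) r~y) out-e out-y)
      (λ { refl → r~e , out-e }))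

  outgoing-at-vertex : ∀ r → Vertices.orbitSum outgoing r ≡ 3
  outgoing-at-vertex r = begin
    Vertices.orbitSum outgoing r                                                     ≡⟨ Vertices.orbitSum≡sum outgoing r ⟩
    sum (λ y → 𝟙 (Vertices.sameOrbit? r y) * outgoing y)                             ≡⟨ sum-cong-≗ (λ y → cong (𝟙 (Vertices.sameOrbit? r y) *_) (𝟙-just≡sum (out y))) ⟩
    sum (λ y → 𝟙 (Vertices.sameOrbit? r y) * sum (λ c → 𝟙 (out y ≟-out just c)))     ≡⟨ sum-cong-≗ (λ y → *-distribˡ-sum {3} (𝟙 (Vertices.sameOrbit? r y)) (λ c → 𝟙 (out y ≟-out just c))) ⟩
    sum (λ y → sum (λ c → 𝟙 (Vertices.sameOrbit? r y) * 𝟙 (out y ≟-out just c)))     ≡⟨ ∑-comm {D} {3} (λ y c → 𝟙 (Vertices.sameOrbit? r y) * 𝟙 (out y ≟-out just c)) ⟩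
    sum (λ c → sum (λ y → 𝟙 (Vertices.sameOrbit? r y) * 𝟙 (out y ≟-out just c)))     ≡⟨ sum-cong-≗ (λ c → sum-cong-≗ (vertex-colour-δ r c)) ⟩
    sum (λ c → sum (λ y → 𝟙 (proj₁ (outExists r c) ≟ y)))                      ≡⟨ sum-cong-≗ (λ c → sum-δ (proj₁ (outExists r c))) ⟩
    3                                                                         ∎
    where open ≡-Reasoning

  -- the label changes around a vertex sit just before its outgoing darts
  vertex-changes : ∀ d → Vertices.orbitSum (labelChange σ lab) d ≡ 3
  vertex-changes d = begin
    ∑< (Vertices.period d) (λ j → labelChange σ lab (iter σ j d))   ≡⟨ ∑<-cong (Vertices.period d) (λ j _ → vertex-labelChange (iter σ j d)) ⟩
    ∑< (Vertices.period d) (λ j → outgoing (iter σ (suc j) d))      ≡⟨ ∑<-rotate-suc (Vertices.period d) (λ j → outgoing (iter σ j d)) (cong outgoing (Vertices.period-returns d)) ⟩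
    Vertices.orbitSum outgoing d                                    ≡⟨ outgoing-at-vertex d ⟩
    3                                                        ∎
    where open ≡-Reasoning

  ρ φ : Fin D → Fin D
  ρ x = σ⁻ (α x)
  φ x = α (σ x)

  φ∘ρ : ∀ x → φ (ρ x) ≡ x
  φ∘ρ x = trans (cong α (σσ⁻ (α x))) (α-invol x)

  ρ∘φ : ∀ x → ρ (φ x) ≡ x
  ρ∘φ x = trans (cong σ⁻ (α-invol (σ x))) (σ⁻σ x)

  module Faces = Orbits ρ φ φ∘ρ

  lab∘ρ≡labelBefore : ∀ x → lab (ρ x) ≡ labelBefore (out (α x)) (out x)
  lab∘ρ≡labelBefore x = trans (lab∘σ⁻≡labelBefore (α x)) (cong (λ m → labelBefore (out (α x)) m) (cong out (α-invol x)))

  face-forward : ForwardSteps ρ lab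
  face-forward x = subst₂ (λ a b → b ≡ a ⊎ b ≡ next a) (sym (lab≡labelAfter x)) (sym (lab∘ρ≡labelBefore x))
    (face-step (edge-orientation x))

  face-unchanged : ∀ x → lab (ρ x) ≡ lab x → out x ≡ just (next (lab x)) × out (α x) ≡ just (prev (lab x))
  face-unchanged x unchanged = subst (λ a → out x ≡ just (next a) × out (α x) ≡ just (prev a)) (sym (lab≡labelAfter x))
    (face-unchanged⇒two-way (edge-orientation x)
      (trans (sym (lab∘ρ≡labelBefore x)) (trans unchanged (lab≡labelAfter x))))

  faceChange : Fin D → ℕ
  faceChange = labelChange ρ lab

  edge-identity : ∀ x → faceChange x + faceChange (α x) + (outgoing x + outgoing (α x)) ≡ 3
  edge-identity x = trans (cong₂ (λ a b → a + b + (outgoing x + outgoing (α x)))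
      (cong₂ changed (lab≡labelAfter x) (lab∘ρ≡labelBefore x))
      (cong₂ changed (trans (lab≡labelAfter (α x)) (cong (labelAfter (out (α x))) out-ααx))
                     (trans (lab∘ρ≡labelBefore (α x)) (cong (λ m → labelBefore m (out (α x))) out-ααx))))
    (edge-count (edge-orientation x))
    where
    out-ααx : out (α (α x)) ≡ out x
    out-ααx = cong out (α-invol x)

  monoCycle-entered : ∀ {i} (C : MonoCycle M out i) l →
    Σ (Fin D) λ δ → SameVertex M δ (MonoCycle.dart C l) × out (α δ) ≡ just i
  monoCycle-entered {i} C l = α (dart (l + pred len)) , subst (SameVertex M _) wraps (linked (l + pred len)) ,
    trans (cong out (α-invol _)) (colored (l + pred len))
    where
    open MonoCycle C
    wraps : dart (suc (l + pred len)) ≡ dart l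
    wraps = trans (cong dart (trans (sym (+-suc l (pred len))) (cong (l +_) (suc-pred len {{>-nonZero len>0}}))))
                  (periodic l)

  between-consecutive : ∀ {a δ} → Between M a δ (σ a) → δ ≡ a ⊎ δ ≡ σ a
  between-consecutive (zero , _ , _ , zero , _ , a≡δ) = inj₁ (sym a≡δ)
  between-consecutive (1 , _ , _ , zero , _ , a≡δ) = inj₁ (sym a≡δ)
  between-consecutive (1 , _ , _ , 1 , _ , σa≡δ) = inj₂ (sym σa≡δ)
  between-consecutive (1 , _ , _ , suc (suc k) , s≤s () , _)
  between-consecutive (suc (suc l) , _ , first , _) = ⊥-elim (first 1 (s≤s (s≤s z≤n)) refl)

  no-change⇒constant : ∀ r → Faces.orbitSum faceChange r ≡ 0 → ∀ {y} → SameOrbit ρ r y → lab y ≡ lab r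
  no-change⇒constant r none (k , refl) with Faces.iter-reduce r k
  ... | j , j<p , eq = trans (cong lab eq) (trans (colour≡height j) (cong (λ h → iter next h (lab r)) height≡0))
    where
    open ColourWalk (λ j → lab (iter ρ j r)) (λ j → face-forward (iter ρ j r))
    height≡0 : height j ≡ 0
    height≡0 = n≤0⇒n≡0 (≤-trans (∑<-mono-≤ change (<⇒≤ j<p)) (≤-reflexive none))

  module UnchangingFace (r : Fin D) (none : Faces.orbitSum faceChange r ≡ 0) where

    two-way : ∀ {y} → SameOrbit ρ r y → out y ≡ just (next (lab r)) × out (α y) ≡ just (prev (lab r))
    two-way {y} r~y = subst (λ a → out y ≡ just (next a) × out (α y) ≡ just (prev a))
      (no-change⇒constant r none r~y)
      (face-unchanged y (trans (no-change⇒constant r none (Faces.orbit-trans r~y (1 , refl)))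
                               (sym (no-change⇒constant r none r~y))))

    φ-in-face : ∀ k → SameOrbit ρ r (φ (iter ρ k r))
    φ-in-face k = Faces.orbit-trans (k , refl) (Faces.orbit-sym (1 , ρ∘φ (iter ρ k r)))

    face-cycle : MonoCycle M out (next (lab r))
    face-cycle = record
      { len = Faces.period r ; len>0 = s≤s z≤n ; dart = λ k → iter ρ k r ; periodic = Faces.iter-periodic r
      ; colored = λ k → proj₁ (two-way (k , refl))
      ; linked = λ k → Vertices.orbit-sym (σ⁻-same-vertex (α (iter ρ k r))) }

    contradiction : ⊥
    contradiction with T2-prev (next (lab r)) face-cycle
    ... | C , k , l , meet with monoCycle-entered C l
    ...   | δ , δ~C , out-αδ with between-consecutive (inSector δ (prev (next (lab r))) d (σ d) δ~d
                                    (Vertices.orbit-trans δ~d (1 , refl)) out-αδ out-d out-σd)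
      where
      d = iter ρ k r
      δ~d = Vertices.orbit-trans δ~C (Vertices.orbit-sym meet)
      out-d = trans (proj₁ (two-way (k , refl))) (cong (just ∘ next) (sym (prev∘next (lab r))))
      out-σd = trans (cong out (sym (α-invol (σ d)))) (trans (proj₂ (two-way (φ-in-face k)))
                     (cong (just ∘ prev) (sym (prev∘next (lab r)))))
    ... | inj₁ refl = prev≢id (lab r) (trans (just-injective (trans (sym (proj₂ (two-way (k , refl)))) out-αδ))
                                             (prev∘next (lab r)))
    ... | inj₂ refl = next≢id (lab r) (trans (just-injective (trans (sym (proj₁ (two-way (φ-in-face k)))) out-αδ))
                                             (prev∘next (lab r)))

  face-has-change : ∀ r → Faces.orbitSum faceChange r ≢ 0
  face-has-change r none = UnchangingFace.contradiction r none

  module Edges = Orbits α α α-invol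

  edge-period : ∀ r → Edges.period r ≡ 2
  edge-period r with Edges.period-of r
  ... | record { q = 0 ; returns = returns } = ⊥-elim (α-nofix r returns)
  ... | record { q = 1 } = refl
  ... | record { q = suc (suc _) ; minimal = minimal } = ⊥-elim (minimal 2 (s≤s z≤n) (s≤s (s≤s (s≤s z≤n))) (α-invol r))

  edge-orbitSum : ∀ h r → Edges.orbitSum h r ≡ h r + h (α r)
  edge-orbitSum h r = trans (cong (λ p → ∑< p (λ j → h (iter α j r))) (edge-period r)) (cong (h r +_) (+-identityʳ _))

  sum-over-edges : sum (λ x → faceChange x + outgoing x) ≡ 3 * numOrbits α
  sum-over-edges = Edges.sum≡orbitSum*numOrbits _ 3 λ r → begin
    Edges.orbitSum (λ x → faceChange x + outgoing x) r                       ≡⟨ edge-orbitSum (λ x → faceChange x + outgoing x) r ⟩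
    faceChange r + outgoing r + (faceChange (α r) + outgoing (α r))           ≡⟨ interchange (faceChange r) _ _ _ ⟩
    faceChange r + faceChange (α r) + (outgoing r + outgoing (α r))           ≡⟨ edge-identity r ⟩
    3                                                                       ∎
    where open ≡-Reasoning

  sum-over-vertices : sum outgoing ≡ 3 * numOrbits σ
  sum-over-vertices = Vertices.sum≡orbitSum*numOrbits outgoing 3 outgoing-at-vertex

  sum-over-faces : sum faceChange ≡ 3 * numOrbits ρ
  sum-over-faces = +-cancelʳ-≡ (3 * numOrbits σ) _ _ (begin
    sum faceChange + 3 * numOrbits σ             ≡⟨ cong (sum faceChange +_) sum-over-vertices ⟨
    sum faceChange + sum outgoing                ≡⟨ ∑-distrib-+ faceChange outgoing ⟨
    sum (λ x → faceChange x + outgoing x)        ≡⟨ sum-over-edges ⟩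
    3 * numOrbits α                              ≡⟨ cong (3 *_) euler ⟨
    3 * (numOrbits σ + numOrbits φ)              ≡⟨ cong (λ f → 3 * (numOrbits σ + f)) (numOrbits-inverse ρ φ φ∘ρ ρ∘φ) ⟩
    3 * (numOrbits σ + numOrbits ρ)              ≡⟨ *-distribˡ-+ 3 (numOrbits σ) (numOrbits ρ) ⟩
    3 * numOrbits σ + 3 * numOrbits ρ            ≡⟨ +-comm (3 * numOrbits σ) _ ⟩
    3 * numOrbits ρ + 3 * numOrbits σ            ∎)
    where open ≡-Reasoning

  face-changes≥3 : ∀ r → 3 ≤ Faces.orbitSum faceChange r
  face-changes≥3 r = ColourWalk.closed-walk-changes≥3 (λ j → lab (iter ρ j r)) (λ j → face-forward (iter ρ j r))
    (Faces.period r) (cong lab (Faces.period-returns r)) (face-has-change r)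

  face-changes : ∀ r → IsOrbitRep ρ r → Faces.orbitSum faceChange r ≡ 3
  face-changes = Faces.orbitSums-tight faceChange 3 face-changes≥3 sum-over-faces

lemma12 : (M : ToroidalMap) (W : SchnyderWood M)
    (lab : Fin (ToroidalMap.D M) → Color) → IsAngleLabeling M W lab →
    (∀ d → ThreeIntervals (ToroidalMap.σ M) lab d) ×
    (∀ d → ThreeIntervals (λ x → ToroidalMap.σ⁻ M (ToroidalMap.α M x)) lab d)
lemma12 M W lab labeling = vertex-intervals , face-intervals
  where
  open AngleLabeling M W lab labeling

  vertex-intervals : ∀ d → ThreeIntervals (ToroidalMap.σ M) lab d
  vertex-intervals d =
    Vertices.three-changes⇒three-intervals lab vertex-forward d (vertex-changes d) d (Vertices.orbit-refl d)

  face-intervals : ∀ d → ThreeIntervals ρ lab d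
  face-intervals d = let r , rep , r~d = Faces.rep-exists d in
    Faces.three-changes⇒three-intervals lab face-forward r (face-changes r rep) d r~d
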